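{- Let $d\geq 2$, $\mathbf{k}=(k_1,\dots,k_{d+1})$ positive integers and $1\le k\le d+1$. Every $(d+1-k)$-dimensional face of the Heawood complex $H_{\mathbf{k}}$ can be obtained uniquely as (the class of) $[B_1,\dots,B_k]+v$ for an ordered partition $[B_1,\dots,B_k]$ of $[d+1]$ with $1\in B_1$ and a class $v\in\Lambda_d/L_{\mathbf{k}}$.
   Context: $\mathrm{Perm}_d=\operatorname{conv}\{(\sigma(1),\dots,\sigma(d+1)):\sigma\in\mathfrak S_{d+1}\}\subset\mathbb{R}^{d+1}$; $w_i=(d+1)e_i-\sum_je_j$, $\Lambda_d=\mathbb{Z}$-span of the $w_i$. $M_{\mathbf{k}}$ is the $(d+1)\times(d+1)$ integer matrix whose $i$-th row has entry $k_i+1$ in column $i$, entry $-k_{i+1}$ in column $i+1$ (indices cyclic mod $d+1$), zeros elsewhere; $L_{\mathbf{k}}=\{\sum a_iw_i: a=bM_{\mathbf{k}},\ b\in\mathbb{Z}^{d+1}\}$. The permutahedral tiling $\mathcal P_d$ consists of the tiles $\mathrm{Perm}_d+v$, $v\in\Lambda_d$, and their faces; the Heawood complex $H_{\mathbf{k}}$ has as faces the classes of faces of $\mathcal P_d$ under translation by $L_{\mathbf{k}}$. An ordered partition $[B_1,\dots,B_k]$ of $[d+1]$ labels the face of $\mathrm{Perm}_d$ given as the convex hull of permutation vectors $(x_1,\dots,x_{d+1})$ of $[d+1]$ with $\{x_a: a\in B_i\}=\{b_{i-1}+1,\dots,b_i\}$, $b_i=|B_1|+\dots+|B_i|$, $b_0=0$;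 $[B_1,\dots,B_k]+v$ is its translate by $v$. -}

module Defs where

open import Data.Nat as ℕ using (ℕ; zero; suc; _≡ᵇ_; _%_)
open import Data.Integer as ℤ using (ℤ; +_; _+_; _-_; _*_; -_; _<_; _≤_)
open import Data.Fin using (Fin; zero; suc; toℕ)
open import Data.Fin.Properties using (_≟_)
open import Data.Bool using (Bool; true; false; if_then_else_)
open import Data.Product using (Σ; ∃; _×_; _,_)
open import Relation.Nullary.Decidable using (⌊_⌋)
open import Relation.Binary.PropositionalEquality using (_≡_)
open import Function.Definitions using (Injective)

-- Points of ℤ^m, m = d+1, coordinates indexed by Fin m (0-indexed).
Pt : ℕ → Set
Pt m = Fin m → ℤ

_+ᵖ_ : ∀ {m} → Pt m → Pt m → Pt m
(x +ᵖ y) j = x j + y j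

_-ᵖ_ : ∀ {m} → Pt m → Pt m → Pt m
(x -ᵖ y) j = x j - y j

sumℤ : ∀ {m} → (Fin m → ℤ) → ℤ
sumℤ {zero}  f = + 0
sumℤ {suc m} f = f zero + sumℤ (λ i → f (suc i))

countℕ : ∀ {m} → (Fin m → Bool) → ℕ
countℕ {zero}  p = 0
countℕ {suc m} p = (if p zero then 1 else 0) ℕ.+ countℕ (λ i → p (suc i))

-- w_i = (d+1) e_i - Σ_j e_j   (here m = d+1)
wvec : (m : ℕ) → Fin m → Pt m
wvec m i j = (if ⌊ i ≟ j ⌋ then + m else + 0) - + 1

combo : (m : ℕ) → (Fin m → ℤ) → Pt m
combo m a j = sumℤ (λ i → a i * wvec m i j)

InΛ : (m : ℕ) → Pt m → Set
InΛ m v = ∃ λ (a : Fin m → ℤ) → ∀ j → v j ≡ combo m a j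

Mk : (d : ℕ) → (Fin (suc d) → ℕ) → Fin (suc d) → Fin (suc d) → ℤ
Mk d k i j =
  if toℕ j ≡ᵇ toℕ i then + (k i ℕ.+ 1)
  else if toℕ j ≡ᵇ (suc (toℕ i) % suc d) then - (+ (k j))
  else + 0

rowMul : (d : ℕ) → (Fin (suc d) → ℕ) → (Fin (suc d) → ℤ) → Fin (suc d) → ℤ
rowMul d k b j = sumℤ (λ i → b i * Mk d k i j)

InL : (d : ℕ) → (Fin (suc d) → ℕ) → Pt (suc d) → Set
InL d k v = ∃ λ (b : Fin (suc d) → ℤ) → ∀ j → v j ≡ combo (suc d) (rowMul d k b) j

-- Ordered partition [B_1,…,B_n] of [m] into n (nonempty) blocks, encoded by
-- the block-index map β : Fin m → Fin n (a ∈ B_{β a + 1}), surjective.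
OrdPart : ℕ → ℕ → Set
OrdPart m n = Σ (Fin m → Fin n) λ β → ∀ (t : Fin n) → ∃ λ a → β a ≡ t

-- b_t = |B_1| + … + |B_t|  (number of elements in the first t blocks)
bnd : ∀ {m n} → (Fin m → Fin n) → ℕ → ℕ
bnd β t = countℕ (λ a → suc (toℕ (β a)) ℕ.≤ᵇ t)

IsPermVec : (m : ℕ) → Pt m → Set
IsPermVec m x = Σ (Fin m → Fin m) λ σ → Injective _≡_ _≡_ σ × (∀ a → x a ≡ + suc (toℕ (σ a)))

-- x is a vertex of the face [B_1,…,B_n] of Perm_d:
-- a permutation vector with {x_a : a ∈ B_i} = {b_{i-1}+1,…,b_i}.
InVert : ∀ {m n} → OrdPart m n → Pt m → Set
InVert {m} (β , _) x =
  IsPermVec m x ×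
  (∀ a → (+ bnd β (toℕ (β a)) < x a) × (x a ≤ + bnd β (suc (toℕ (β a)))))

InFace : ∀ {m n} → OrdPart m n → Pt m → Pt m → Set
InFace B v x = InVert B (x -ᵖ v)

-- [B]+v and [C]+w are the same face of the permutahedral tiling
-- (same polytope ⇔ same vertex set)
SameFace : ∀ {m n n'} → OrdPart m n → Pt m → OrdPart m n' → Pt m → Set
SameFace B v C w = ∀ x → (InFace B v x → InFace C w x) × (InFace C w x → InFace B v x)

-- [B]+v and [C]+w define the same face of the Heawood complex H_k
-- (they differ by a translation in L_k)
SameFaceH : (d : ℕ) → (Fin (suc d) → ℕ) → ∀ {n n'} →
            OrdPart (suc d) n → Pt (suc d) → OrdPart (suc d) n' → Pt (suc d) → Set
SameFaceH d k B v C w = ∃ λ ℓ → InL d k ℓ × SameFace B (v +ᵖ ℓ) C w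

-- Every face [B] + v (v ∈ Λ) can be brought into normal form: the face
-- [B₁, …, Bₖ] + v equals [B₂, …, Bₖ, B₁] + (v - Σ_{a ∈ B₁} w_a), and iterating
-- moves the block containing 1 to the front. For uniqueness, let
-- [B′] + u′ = [B] + u with 1 in the first block of both and u′ - u ∈ Λ. The
-- vertex of [B′] + u′ whose first relative coordinate is 1 is a vertex of
-- [B] + u, so u′₁ ≥ u₁, and symmetrically u′₁ ≤ u₁; the coordinates of u′ - u
-- are congruent modulo d + 1 and less than d + 1 in absolute value, so u′ = u.
-- Equal vertex sets then give equal ordered partitions, because a lies in an
-- earlier block than b iff x_a < x_b at every vertex x. As L_k ⊆ Λ_d, the same
-- holds for classes modulo L_k.
module Submission where

open import Defs

open import Data.Bool using (Bool; true; false; if_then_else_; T)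
open import Data.Bool.Properties using (if-float)
open import Data.Empty using (⊥-elim)
open import Data.Fin as Fin
  using (Fin; zero; suc; toℕ; fromℕ; fromℕ<; inject₁; lower₁; combine)
import Data.Fin.Properties as Finₚ
open import Data.Fin.Permutation.Components using (transpose; transpose-inverse)
open import Data.Integer as ℤ
  using (ℤ; +_; -[1+_]; _+_; _-_; _*_; -_; +≤+; +<+)
import Data.Integer.Properties as ℤₚ
open import Data.Integer.Tactic.RingSolver using (solve-∀)
open import Data.Nat as ℕ using (ℕ; zero; suc; _≤_; _<_; z≤n; s≤s; z<s; _≤ᵇ_; _<ᵇ_)
import Data.Nat.Properties as ℕₚ
open import Data.Product using (Σ; ∃; _×_; _,_; proj₁; proj₂)
open import Data.Unit using (tt)
open import Function using (_∘_; id)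
open import Function.Definitions using (Injective)
open import Relation.Binary.Definitions using (tri<; tri≈; tri>)
open import Relation.Binary.PropositionalEquality
open import Relation.Nullary using (¬_; yes; no; _because_)
open import Relation.Nullary.Decidable using (⌊_⌋; dec-true)

open import Algebra.Properties.CommutativeMonoid.Sum ℤₚ.+-0-commutativeMonoid
  using (sum; sum-cong-≗; ∑-distrib-+; sum-replicate-zero)
open import Algebra.Properties.AbelianGroup ℤₚ.+-0-abelianGroup
  using (∙-cancelʳ; //-rightDividesʳ)
open import Algebra.Properties.CommutativeSemigroup ℕₚ.+-commutativeSemigroup using (interchange)

indicator : Bool → ℕ
indicator b = if b then 1 else 0

indicator-mono : ∀ p q → (T p → T q) → indicator p ≤ indicator q
indicator-mono false _     _   = z≤n
indicator-mono true  true  _   = ℕₚ.≤-refl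
indicator-mono true  false p⇒q = ⊥-elim (p⇒q tt)

indicator-< : ∀ p q → T q → ¬ T p → indicator p < indicator q
indicator-< false true  _  _  = z<s
indicator-< true  _     _  ¬p = ⊥-elim (¬p tt)

indicator-true : ∀ {b} → T b → indicator b ≡ 1
indicator-true {true} _ = refl

indicator-false : ∀ {b} → ¬ T b → indicator b ≡ 0
indicator-false {false} _  = refl
indicator-false {true}  ¬b = ⊥-elim (¬b tt)

count-mono : ∀ {m} (p q : Fin m → Bool) → (∀ a → T (p a) → T (q a)) →
             countℕ p ≤ countℕ q
count-mono {zero}  p q p⇒q = z≤n
count-mono {suc m} p q p⇒q =
  ℕₚ.+-mono-≤ (indicator-mono (p zero) (q zero) (p⇒q zero))
              (count-mono (p ∘ suc) (q ∘ suc) (p⇒q ∘ suc))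

count-< : ∀ {m} (p q : Fin m → Bool) → (∀ a → T (p a) → T (q a)) →
          ∀ b → T (q b) → ¬ T (p b) → countℕ p < countℕ q
count-< {suc m} p q p⇒q zero qb ¬pb =
  ℕₚ.+-mono-<-≤ (indicator-< (p zero) (q zero) qb ¬pb)
                (count-mono (p ∘ suc) (q ∘ suc) (p⇒q ∘ suc))
count-< {suc m} p q p⇒q (suc b) qb ¬pb =
  ℕₚ.+-mono-≤-< (indicator-mono (p zero) (q zero) (p⇒q zero))
                (count-< (p ∘ suc) (q ∘ suc) (p⇒q ∘ suc) b qb ¬pb)

count-all : ∀ {m} (p : Fin m → Bool) → (∀ a → T (p a)) → countℕ p ≡ m
count-all {zero}  p all = refl
count-all {suc m} p all =
  cong₂ ℕ._+_ (indicator-true (all zero)) (count-all (p ∘ suc) (all ∘ suc))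

count-none : ∀ {m} (p : Fin m → Bool) → (∀ a → ¬ T (p a)) → countℕ p ≡ 0
count-none {zero}  p none = refl
count-none {suc m} p none =
  cong₂ ℕ._+_ (indicator-false (none zero)) (count-none (p ∘ suc) (none ∘ suc))

count-+ : ∀ {m} (p q r : Fin m → Bool) →
          (∀ a → indicator (p a) ℕ.+ indicator (q a) ≡ indicator (r a)) →
          countℕ p ℕ.+ countℕ q ≡ countℕ r
count-+ {zero}  p q r p+q≡r = refl
count-+ {suc m} p q r p+q≡r =
  trans (interchange (indicator (p zero)) _ (indicator (q zero)) _)
        (cong₂ ℕ._+_ (p+q≡r zero) (count-+ (p ∘ suc) (q ∘ suc) (r ∘ suc) (p+q≡r ∘ suc)))

module _ {m n : ℕ} (β : Fin m → Fin n) where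

  below : ℕ → Fin m → Bool
  below t a = suc (toℕ (β a)) ≤ᵇ t

  bnd-mono : ∀ {t u} → t ≤ u → bnd β t ≤ bnd β u
  bnd-mono {t} {u} t≤u = count-mono (below t) (below u) λ a βa<t →
    ℕₚ.<⇒<ᵇ (ℕₚ.<-≤-trans (ℕₚ.<ᵇ⇒< (toℕ (β a)) t βa<t) t≤u)

  bnd-zero : bnd β 0 ≡ 0
  bnd-zero = count-none (below 0) λ a ()

  bnd-full : bnd β n ≡ m
  bnd-full = count-all (below n) λ a → ℕₚ.<⇒<ᵇ (Finₚ.toℕ<n (β a))

sumℤ≡sum : ∀ {m} (f : Fin m → ℤ) → sumℤ f ≡ sum f
sumℤ≡sum {zero}  f = refl
sumℤ≡sum {suc m} f = cong (_+_ (f zero)) (sumℤ≡sum (f ∘ suc))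

sumℤ-cong : ∀ {m} {f g : Fin m → ℤ} → f ≗ g → sumℤ f ≡ sumℤ g
sumℤ-cong {f = f} {g} f≗g =
  trans (sumℤ≡sum f) (trans (sum-cong-≗ f≗g) (sym (sumℤ≡sum g)))

sumℤ-+ : ∀ {m} (f g : Fin m → ℤ) → sumℤ (λ i → f i + g i) ≡ sumℤ f + sumℤ g
sumℤ-+ f g = begin
  sumℤ (λ i → f i + g i)  ≡⟨ sumℤ≡sum (λ i → f i + g i) ⟩
  sum (λ i → f i + g i)   ≡⟨ ∑-distrib-+ f g ⟩
  sum f + sum g           ≡⟨ sym (cong₂ _+_ (sumℤ≡sum f) (sumℤ≡sum g)) ⟩
  sumℤ f + sumℤ g         ∎
  where open ≡-Reasoning

sumℤ-zero : ∀ {m} → sumℤ {m} (λ _ → + 0) ≡ + 0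
sumℤ-zero {m} = trans (sumℤ≡sum {m} (λ _ → + 0)) (sum-replicate-zero m)

sumℤ-neg : ∀ {m} (f : Fin m → ℤ) → sumℤ (λ i → - f i) ≡ - sumℤ f
sumℤ-neg {zero}  f = refl
sumℤ-neg {suc m} f =
  trans (cong (_+_ (- f zero)) (sumℤ-neg (f ∘ suc))) (sym (ℤₚ.neg-distrib-+ (f zero) _))

sumℤ-δ : ∀ {m} (f : Fin m → ℤ) j → sumℤ (λ i → if ⌊ i Finₚ.≟ j ⌋ then f i else + 0) ≡ f j
sumℤ-δ {suc m} f zero =
  trans (cong (_+_ (f zero)) (sumℤ-zero {m})) (ℤₚ.+-identityʳ (f zero))
sumℤ-δ {suc m} f (suc j) =
  trans (ℤₚ.+-identityˡ _) (trans (sumℤ-cong same-test) (sumℤ-δ (f ∘ suc) j))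
  where
  same-test : ∀ i → (if ⌊ suc i Finₚ.≟ suc j ⌋ then f (suc i) else + 0)
                  ≡ (if ⌊ i Finₚ.≟ j ⌋ then f (suc i) else + 0)
  same-test i with i Finₚ.≟ j
  ... | true  because _ = refl
  ... | false because _ = refl

sumℤ-indicator : ∀ {m} (p : Fin m → Bool) →
                 sumℤ (λ i → if p i then + 1 else + 0) ≡ + countℕ p
sumℤ-indicator {zero}  p = refl
sumℤ-indicator {suc m} p =
  cong₂ _+_ (sym (if-float +_ (p zero))) (sumℤ-indicator (p ∘ suc))

sumℤ-lin-+ : ∀ {m} (f f′ g : Fin m → ℤ) →
             sumℤ (λ i → (f i + f′ i) * g i)
               ≡ sumℤ (λ i → f i * g i) + sumℤ (λ i → f′ i * g i)
sumℤ-lin-+ f f′ g =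
  trans (sumℤ-cong λ i → ℤₚ.*-distribʳ-+ (g i) (f i) (f′ i))
        (sumℤ-+ (λ i → f i * g i) (λ i → f′ i * g i))

sumℤ-lin-neg : ∀ {m} (f g : Fin m → ℤ) →
               sumℤ (λ i → (- f i) * g i) ≡ - sumℤ (λ i → f i * g i)
sumℤ-lin-neg f g =
  trans (sumℤ-cong λ i → sym (ℤₚ.neg-distribˡ-* (f i) (g i))) (sumℤ-neg (λ i → f i * g i))

combo-formula : ∀ m (a : Fin m → ℤ) j → combo m a j ≡ a j * + m - sumℤ a
combo-formula m a j = begin
  combo m a j                                                      ≡⟨ sumℤ-cong split ⟩
  sumℤ (λ i → (if ⌊ i Finₚ.≟ j ⌋ then a i * + m else + 0) + - a i)
    ≡⟨ sumℤ-+ (λ i → if ⌊ i Finₚ.≟ j ⌋ then a i * + m else + 0) (λ i → - a i) ⟩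
  sumℤ (λ i → if ⌊ i Finₚ.≟ j ⌋ then a i * + m else + 0) + sumℤ (λ i → - a i)
    ≡⟨ cong₂ _+_ (sumℤ-δ (λ i → a i * + m) j) (sumℤ-neg a) ⟩
  a j * + m - sumℤ a                                               ∎
  where
  open ≡-Reasoning
  diagonal : ∀ x M → x * (M - + 1) ≡ x * M + - x
  diagonal = solve-∀
  off-diagonal : ∀ x → x * (+ 0 - + 1) ≡ + 0 + - x
  off-diagonal = solve-∀
  split : ∀ i → a i * wvec m i j ≡ (if ⌊ i Finₚ.≟ j ⌋ then a i * + m else + 0) + - a i
  split i with ⌊ i Finₚ.≟ j ⌋
  ... | true  = diagonal (a i) (+ m)
  ... | false = off-diagonal (a i)

InΛ-+ : ∀ {m} {u v : Pt m} → InΛ m u → InΛ m v → InΛ m (u +ᵖ v)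
InΛ-+ {m} (a , u≡) (b , v≡) = (λ i → a i + b i) , λ j →
  trans (cong₂ _+_ (u≡ j) (v≡ j)) (sym (sumℤ-lin-+ a b λ i → wvec m i j))

InΛ-− : ∀ {m} {u v : Pt m} → InΛ m u → InΛ m v → InΛ m (u -ᵖ v)
InΛ-− {m} (a , u≡) (b , v≡) = (λ i → a i - b i) , λ j →
  trans (cong₂ _-_ (u≡ j) (v≡ j)) (sym (trans
    (sumℤ-lin-+ a (λ i → - b i) λ i → wvec m i j)
    (cong (_+_ (combo m a j)) (sumℤ-lin-neg b λ i → wvec m i j))))

InL⇒InΛ : ∀ {d k} {v : Pt (suc d)} → InL d k v → InΛ (suc d) v
InL⇒InΛ {d} {k} (b , v≡) = rowMul d k b , v≡

InL-zero : ∀ d k → InL d k (λ _ → + 0)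
InL-zero d k = (λ _ → + 0) , λ j →
  sym (trans (sumℤ-cong λ i → cong (_* wvec (suc d) i j) (sumℤ-zero {suc d})) (sumℤ-zero {suc d}))

InL-neg : ∀ {d k} {ℓ : Pt (suc d)} → InL d k ℓ → InL d k (λ j → - ℓ j)
InL-neg {d} {k} (b , ℓ≡) = (λ i → - b i) , λ j →
  trans (cong -_ (ℓ≡ j)) (sym (trans
    (sumℤ-cong λ i → cong (_* wvec (suc d) i j) (sumℤ-lin-neg b λ i′ → Mk d k i′ i))
    (sumℤ-lin-neg (rowMul d k b) λ i → wvec (suc d) i j)))

InL-resp-≗ : ∀ {d k} {u v : Pt (suc d)} → u ≗ v → InL d k v → InL d k u
InL-resp-≗ u≗v (b , v≡) = b , λ j → trans (u≗v j) (v≡ j)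

Congruent : ∀ {m} → Pt (suc m) → Set
Congruent {m} t = ∀ j → ∃ λ z → t j ≡ t zero + z * + suc m

InΛ⇒Congruent : ∀ {m} {t : Pt (suc m)} → InΛ (suc m) t → Congruent t
InΛ⇒Congruent {m} {t} (a , t≡) j = a j - a zero , (begin
  t j                                        ≡⟨ coordinate j ⟩
  a j * M - sumℤ a                           ≡⟨ regroup (a j) (a zero) (sumℤ a) M ⟩
  (a zero * M - sumℤ a) + (a j - a zero) * M ≡⟨ cong (_+ (a j - a zero) * M) (coordinate zero) ⟨
  t zero + (a j - a zero) * M                ∎)
  where
  open ≡-Reasoning
  M = + suc m
  coordinate : ∀ i → t i ≡ a i * M - sumℤ a
  coordinate i = trans (t≡ i) (combo-formula (suc m) a i)
  regroup : ∀ x y s M → x * M - s ≡ (y * M - s) + (x - y) * M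
  regroup = solve-∀

InBlock : ∀ {m n} → (Fin m → Fin n) → Fin m → ℤ → Set
InBlock β a u = (+ bnd β (toℕ (β a)) ℤ.< u) × (u ℤ.≤ + bnd β (suc (toℕ (β a))))

BlockBounded : ∀ {m n} → (Fin m → Fin n) → Pt m → Set
BlockBounded β y = ∀ a → InBlock β a (y a)

module _ {m n : ℕ} {β : Fin m → Fin n} {y : Pt m} (y-bounded : BlockBounded β y) where

  block-bounded⇒range : ∀ a → (+ 0 ℤ.< y a) × (y a ℤ.≤ + m)
  block-bounded⇒range a =
    ℤₚ.≤-<-trans (+≤+ z≤n) (proj₁ (y-bounded a)) ,
    ℤₚ.≤-trans (proj₂ (y-bounded a))
               (+≤+ (ℕₚ.≤-trans (bnd-mono β (Finₚ.toℕ<n (β a))) (ℕₚ.≤-reflexive (bnd-full β))))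

  block-bounded⇒< : ∀ {a b} → toℕ (β a) < toℕ (β b) → y a ℤ.< y b
  block-bounded⇒< {a} {b} βa<βb =
    ℤₚ.≤-<-trans (proj₂ (y-bounded a))
                 (ℤₚ.≤-<-trans (+≤+ (bnd-mono β βa<βb)) (proj₁ (y-bounded b)))

  block-bounded⇒same-block : ∀ {a b} → y a ≡ y b → β a ≡ β b
  block-bounded⇒same-block {a} {b} ya≡yb with Finₚ.<-cmp (β a) (β b)
  ... | tri< βa<βb _ _ = ⊥-elim (ℤₚ.<⇒≢ (block-bounded⇒< βa<βb) ya≡yb)
  ... | tri≈ _ βa≡βb _ = βa≡βb
  ... | tri> _ _ βb<βa = ⊥-elim (ℤₚ.<⇒≢ (block-bounded⇒< βb<βa) (sym ya≡yb))

range⇒IsPermVec : ∀ {m} {y : Pt m} → (∀ a → (+ 0 ℤ.< y a) × (y a ℤ.≤ + m)) →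
                  Injective _≡_ _≡_ y → IsPermVec m y
range⇒IsPermVec {m} {y} y-range y-injective = σ , σ-injective , σ-spec
  where
  toFin : ∀ z → + 0 ℤ.< z → z ℤ.≤ + m → Σ (Fin m) λ i → z ≡ + suc (toℕ i)
  toFin (+ suc k) _          (+≤+ k<m) = fromℕ< k<m , cong (+_ ∘ suc) (sym (Finₚ.toℕ-fromℕ< k<m))
  toFin (+ zero)  (+<+ ())   _
  σ : Fin m → Fin m
  σ a = proj₁ (toFin (y a) (proj₁ (y-range a)) (proj₂ (y-range a)))
  σ-spec : ∀ a → y a ≡ + suc (toℕ (σ a))
  σ-spec a = proj₂ (toFin (y a) (proj₁ (y-range a)) (proj₂ (y-range a)))
  σ-injective : Injective _≡_ _≡_ σ
  σ-injective {a} {b} σa≡σb =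
    y-injective (trans (σ-spec a) (trans (cong (+_ ∘ suc ∘ toℕ) σa≡σb) (sym (σ-spec b))))

IsPermVec⇒injective : ∀ {m} {y : Pt m} → IsPermVec m y → Injective _≡_ _≡_ y
IsPermVec⇒injective (σ , σ-injective , σ-spec) {a} {b} ya≡yb =
  σ-injective (Finₚ.toℕ-injective (ℕₚ.suc-injective (ℤₚ.+-injective
    (trans (sym (σ-spec a)) (trans ya≡yb (σ-spec b))))))

InVert-intro : ∀ {m n} (B : OrdPart m n) {y : Pt m} →
               BlockBounded (proj₁ B) y → Injective _≡_ _≡_ y → InVert B y
InVert-intro B y-bounded y-injective =
  range⇒IsPermVec (block-bounded⇒range {β = proj₁ B} y-bounded) y-injective , y-bounded

InVert-resp-≗ : ∀ {m n} (B : OrdPart m n) {y z : Pt m} → y ≗ z → InVert B y → InVert B z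
InVert-resp-≗ (β , _) y≗z ((σ , σ-injective , σ-spec) , y-bounded) =
  (σ , σ-injective , λ a → trans (sym (y≗z a)) (σ-spec a)) ,
  λ a → subst (InBlock β a) (y≗z a) (y-bounded a)

+ᵖ-injective : ∀ {m} {y c : Pt m} → Injective _≡_ _≡_ y →
               (∀ {a b} → (y +ᵖ c) a ≡ (y +ᵖ c) b → c a ≡ c b) →
               Injective _≡_ _≡_ (y +ᵖ c)
+ᵖ-injective {y = y} {c} y-injective c-constant {a} {b} e =
  y-injective (∙-cancelʳ (c a) (y a) (y b) (trans e (cong (_+_ (y b)) (sym (c-constant e)))))

module FirstInBlock {m n : ℕ} (β : Fin (suc m) → Fin n) (c : Fin (suc m)) where

  τ : Fin (suc m) → Fin (suc m)
  τ = transpose c zero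

  τ-c : τ c ≡ zero
  τ-c rewrite dec-true (c Finₚ.≟ c) refl = refl

  τ-injective : Injective _≡_ _≡_ τ
  τ-injective {a} {b} τa≡τb = begin
    a                      ≡⟨ sym (transpose-inverse zero c) ⟩
    transpose zero c (τ a) ≡⟨ cong (transpose zero c) τa≡τb ⟩
    transpose zero c (τ b) ≡⟨ transpose-inverse zero c ⟩
    b                      ∎
    where open ≡-Reasoning

  -- Ordering the coordinates by key lists the blocks of β in order and puts
  -- c first inside its own block.
  key : Fin (suc m) → Fin (n ℕ.* suc m)
  key a = combine (β a) (τ a)

  key-injective : Injective _≡_ _≡_ key
  key-injective {a} {b} ka≡kb =
    τ-injective (proj₂ (Finₚ.combine-injective (β a) (τ a) (β b) (τ b) ka≡kb))

  key<⇒block≤ : ∀ {x a} → key x Fin.< key a → toℕ (β x) ≤ toℕ (β a)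
  key<⇒block≤ {x} {a} kx<ka = ℕₚ.≮⇒≥ λ βa<βx →
    ℕₚ.<-asym kx<ka (Finₚ.combine-monoˡ-< (τ a) (τ x) βa<βx)

  key<key-c⇒block< : ∀ {x} → key x Fin.< key c → toℕ (β x) < toℕ (β c)
  key<key-c⇒block< {x} kx<kc = ℕₚ.*-cancelˡ-< (suc m) (toℕ (β x)) (toℕ (β c)) (begin-strict
    suc m ℕ.* toℕ (β x)               ≤⟨ ℕₚ.m≤m+n _ (toℕ (τ x)) ⟩
    suc m ℕ.* toℕ (β x) ℕ.+ toℕ (τ x) ≡⟨ Finₚ.toℕ-combine (β x) (τ x) ⟨
    toℕ (key x)                       <⟨ kx<kc ⟩
    toℕ (key c)                       ≡⟨ Finₚ.toℕ-combine (β c) (τ c) ⟩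
    suc m ℕ.* toℕ (β c) ℕ.+ toℕ (τ c) ≡⟨ cong (λ i → suc m ℕ.* toℕ (β c) ℕ.+ toℕ i) τ-c ⟩
    suc m ℕ.* toℕ (β c) ℕ.+ 0         ≡⟨ ℕₚ.+-identityʳ _ ⟩
    suc m ℕ.* toℕ (β c)               ∎)
    where open ℕₚ.≤-Reasoning

  keyBelow : Fin (suc m) → Fin (suc m) → Bool
  keyBelow a x = toℕ (key x) <ᵇ toℕ (key a)

  rank : Fin (suc m) → ℕ
  rank a = countℕ (keyBelow a)

  keyBelow-irrefl : ∀ a → ¬ T (keyBelow a a)
  keyBelow-irrefl a ka<ka = ℕₚ.<-irrefl refl (ℕₚ.<ᵇ⇒< (toℕ (key a)) _ ka<ka)

  rank-mono : ∀ {a b} → key a Fin.< key b → rank a < rank b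
  rank-mono {a} {b} ka<kb = count-< (keyBelow a) (keyBelow b)
    (λ x kx<ka → ℕₚ.<⇒<ᵇ (ℕₚ.<-trans (ℕₚ.<ᵇ⇒< (toℕ (key x)) _ kx<ka) ka<kb))
    a (ℕₚ.<⇒<ᵇ ka<kb) (keyBelow-irrefl a)

  rank-injective : Injective _≡_ _≡_ rank
  rank-injective {a} {b} ra≡rb with Finₚ.<-cmp (key a) (key b)
  ... | tri< ka<kb _ _ = ⊥-elim (ℕₚ.<⇒≢ (rank-mono ka<kb) ra≡rb)
  ... | tri≈ _ ka≡kb _ = key-injective ka≡kb
  ... | tri> _ _ kb<ka = ⊥-elim (ℕₚ.<⇒≢ (rank-mono kb<ka) (sym ra≡rb))

  bnd≤rank : ∀ a → bnd β (toℕ (β a)) ≤ rank a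
  bnd≤rank a = count-mono (below β (toℕ (β a))) (keyBelow a) λ x βx<βa →
    ℕₚ.<⇒<ᵇ (Finₚ.combine-monoˡ-< (τ x) (τ a) (ℕₚ.<ᵇ⇒< (toℕ (β x)) _ βx<βa))

  rank<bnd : ∀ a → rank a < bnd β (suc (toℕ (β a)))
  rank<bnd a = count-< (keyBelow a) (below β (suc (toℕ (β a))))
    (λ x kx<ka → ℕₚ.<⇒<ᵇ (s≤s (key<⇒block≤ (ℕₚ.<ᵇ⇒< (toℕ (key x)) _ kx<ka))))
    a (ℕₚ.<⇒<ᵇ (ℕₚ.n<1+n (toℕ (β a)))) (keyBelow-irrefl a)

  rank-c : rank c ≡ bnd β (toℕ (β c))
  rank-c = ℕₚ.≤-antisym
    (count-mono (keyBelow c) (below β (toℕ (β c))) λ x kx<kc →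
      ℕₚ.<⇒<ᵇ (key<key-c⇒block< (ℕₚ.<ᵇ⇒< (toℕ (key x)) _ kx<kc)))
    (bnd≤rank c)

  y-bounded : BlockBounded β (λ a → + suc (rank a))
  y-bounded a = +<+ (s≤s (bnd≤rank a)) , +≤+ (rank<bnd a)

first-in-block : ∀ {m n} (B : OrdPart (suc m) n) c →
                 ∃ λ y → InVert B y × y c ≡ + suc (bnd (proj₁ B) (toℕ (proj₁ B c)))
first-in-block (β , onto) c =
  (λ a → + suc (rank a)) ,
  InVert-intro (β , onto) y-bounded (rank-injective ∘ ℕₚ.suc-injective ∘ ℤₚ.+-injective) ,
  cong (+_ ∘ suc) rank-c
  where open FirstInBlock β c

SameFace-refl : ∀ {m n} (B : OrdPart m n) v → SameFace B v B v
SameFace-refl B v x = id , id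

SameFace-sym : ∀ {m n n′} (B : OrdPart m n) {v} (C : OrdPart m n′) {w} →
               SameFace B v C w → SameFace C w B v
SameFace-sym B C B≈C x = proj₂ (B≈C x) , proj₁ (B≈C x)

SameFace-trans : ∀ {m n n′ n″} (B : OrdPart m n) {v} (C : OrdPart m n′) {w} (D : OrdPart m n″) {u} →
                 SameFace B v C w → SameFace C w D u → SameFace B v D u
SameFace-trans B C D B≈C C≈D x =
  proj₁ (C≈D x) ∘ proj₁ (B≈C x) , proj₂ (B≈C x) ∘ proj₂ (C≈D x)

SameFace-resp-≗ : ∀ {m n n′} (B : OrdPart m n) {v v′} (C : OrdPart m n′) {w} →
                  v ≗ v′ → SameFace B v C w → SameFace B v′ C w
SameFace-resp-≗ B C v≗v′ B≈C x =
  (λ x∈B → proj₁ (B≈C x) (InVert-resp-≗ B (λ j → cong (_-_ (x j)) (sym (v≗v′ j))) x∈B)) ,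
  (λ x∈C → InVert-resp-≗ B (λ j → cong (_-_ (x j)) (v≗v′ j)) (proj₂ (B≈C x) x∈C))

SameFace⇒shift : ∀ {m n n′} (B : OrdPart m n) {u} (C : OrdPart m n′) {w} → SameFace B u C w →
                 ∀ {y} → InVert B y → InVert C (y +ᵖ (u -ᵖ w))
SameFace⇒shift B {u} C {w} B≈C {y} y∈B =
  InVert-resp-≗ C (λ j → ℤₚ.+-assoc (y j) (u j) (- w j))
    (proj₁ (B≈C (y +ᵖ u)) (InVert-resp-≗ B (λ j → sym (//-rightDividesʳ (u j) (y j))) y∈B))

SameFace⇒same-vertices : ∀ {m n n′} (B : OrdPart m n) {u} (C : OrdPart m n′) {w} →
                         u ≗ w → SameFace B u C w → ∀ {y} → InVert B y → InVert C y
SameFace⇒same-vertices B C {w} u≗w B≈C {y} y∈B =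
  InVert-resp-≗ C
    (λ j → trans (cong (_+_ (y j)) (ℤₚ.i≡j⇒i-j≡0 (u≗w j))) (ℤₚ.+-identityʳ (y j)))
    (SameFace⇒shift B C B≈C y∈B)

block-order-visible : ∀ {m n} (B : OrdPart (suc m) n) a b →
                      (∀ y → InVert B y → y a ℤ.< y b) → toℕ (proj₁ B a) < toℕ (proj₁ B b)
block-order-visible B@(β , _) a b ya<yb with toℕ (β a) ℕₚ.<? toℕ (β b)
... | yes βa<βb = βa<βb
... | no  βa≮βb =
  let (y , y∈B , yb≡) = first-in-block B b in
  ⊥-elim (ℤₚ.<⇒≱ (ya<yb y y∈B) (begin
    y b                       ≡⟨ yb≡ ⟩
    + suc (bnd β (toℕ (β b))) ≤⟨ +≤+ (s≤s (bnd-mono β (ℕₚ.≮⇒≥ βa≮βb))) ⟩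
    + suc (bnd β (toℕ (β a))) ≤⟨ ℤₚ.i<j⇒suc[i]≤j (proj₁ (proj₂ y∈B a)) ⟩
    y a                       ∎))
  where open ℤₚ.≤-Reasoning

vertices-order : ∀ {m n} (B C : OrdPart (suc m) n) → (∀ {y} → InVert B y → InVert C y) →
                 ∀ {a b} → toℕ (proj₁ C a) < toℕ (proj₁ C b) →
                 toℕ (proj₁ B a) < toℕ (proj₁ B b)
vertices-order B (γ , _) B⊆C γa<γb =
  block-order-visible B _ _ λ y y∈B → block-bounded⇒< (proj₂ (B⊆C y∈B)) γa<γb

-- Induction on the block index of a, using surjectivity of β′ to find a
-- coordinate in the block just before it.
blocks-dominated : ∀ {m n} (β β′ : Fin m → Fin n) → (∀ t → ∃ λ a → β′ a ≡ t) →
                   (∀ {a b} → toℕ (β′ a) < toℕ (β′ b) → toℕ (β a) < toℕ (β b)) →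
                   ∀ a → toℕ (β′ a) ≤ toℕ (β a)
blocks-dominated {m} {n} β β′ β′-onto order a = go (toℕ (β′ a)) a refl
  where
  go : ∀ i a → toℕ (β′ a) ≡ i → i ≤ toℕ (β a)
  go zero    a _    = z≤n
  go (suc i) a β′a≡ = begin
    suc i           ≤⟨ s≤s (go i b β′b≡i) ⟩
    suc (toℕ (β b)) ≤⟨ order β′b<β′a ⟩
    toℕ (β a)       ∎
    where
    open ℕₚ.≤-Reasoning
    i<n : i < n
    i<n = ℕₚ.<-trans (ℕₚ.n<1+n i) (subst (_< n) β′a≡ (Finₚ.toℕ<n (β′ a)))
    b : Fin m
    b = proj₁ (β′-onto (fromℕ< i<n))
    β′b≡i : toℕ (β′ b) ≡ i
    β′b≡i = trans (cong toℕ (proj₂ (β′-onto (fromℕ< i<n)))) (Finₚ.toℕ-fromℕ< i<n)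
    β′b<β′a : toℕ (β′ b) < toℕ (β′ a)
    β′b<β′a = subst₂ _<_ (sym β′b≡i) (sym β′a≡) (ℕₚ.n<1+n i)

same-vertices⇒same-blocks : ∀ {m n} (B C : OrdPart (suc m) n) →
                            (∀ {y} → InVert B y → InVert C y) → (∀ {y} → InVert C y → InVert B y) →
                            proj₁ B ≗ proj₁ C
same-vertices⇒same-blocks B@(β , β-onto) C@(γ , γ-onto) B⊆C C⊆B a =
  Finₚ.toℕ-injective (ℕₚ.≤-antisym
    (blocks-dominated γ β β-onto (vertices-order C B C⊆B) a)
    (blocks-dominated β γ γ-onto (vertices-order B C B⊆C) a))

-- The paper's condition 1 ∈ B₁; coordinates and blocks are indexed from 0.
Normalised : ∀ {m n} → OrdPart (suc m) n → Set
Normalised B = toℕ (proj₁ B zero) ≡ 0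

shift-at-zero-nonneg : ∀ {m n n′} (B : OrdPart (suc m) n) (B′ : OrdPart (suc m) n′) {t : Pt (suc m)} →
                       Normalised B′ → (∀ {y} → InVert B′ y → InVert B (y +ᵖ t)) →
                       + 0 ℤ.≤ t zero
shift-at-zero-nonneg (β , _) B′@(β′ , _) {t} B′-normal shift =
  let (y , y∈B′ , y0≡) = first-in-block B′ zero
      y0≡1 = trans y0≡ (cong (+_ ∘ suc) (trans (cong (bnd β′) B′-normal) (bnd-zero β′)))
      0<y0+t0 = proj₁ (block-bounded⇒range {β = β} (proj₂ (shift y∈B′)) zero)
  in subst (+ 0 ℤ.≤_) (ℤₚ.pred-suc (t zero))
       (ℤₚ.i<j⇒i≤pred[j] (subst (λ u → + 0 ℤ.< u + t zero) y0≡1 0<y0+t0))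

multiple-in-range : ∀ M {p} z → + 0 ℤ.< p → p ℤ.≤ + M →
                    + 0 ℤ.< p + z * + M → p + z * + M ℤ.≤ + M → z * + M ≡ + 0
multiple-in-range M (+ zero)  _   _   _       _      = refl
multiple-in-range M (+ suc k) 0<p _   _       p+zM≤M =
  ⊥-elim (ℤₚ.<⇒≱ (ℤₚ.+-mono-<-≤ 0<p M≤zM) p+zM≤M)
  where
  M≤zM : + M ℤ.≤ + suc k * + M
  M≤zM = subst (+ M ℤ.≤_) (ℤₚ.pos-* (suc k) M) (+≤+ (ℕₚ.m≤m+n M (k ℕ.* M)))
multiple-in-range M {p} -[1+ k ] _ p≤M 0<p+zM _ =
  ⊥-elim (ℤₚ.<⇒≱ 0<p+zM
    (subst (p + -[1+ k ] * + M ℤ.≤_) (ℤₚ.+-inverseʳ (+ M)) (ℤₚ.+-mono-≤ p≤M zM≤-M)))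
  where
  zM≤-M : -[1+ k ] * + M ℤ.≤ - + M
  zM≤-M = subst (ℤ._≤ - + M)
                (trans (cong -_ (ℤₚ.pos-* (suc k) M)) (ℤₚ.neg-distribˡ-* (+ suc k) (+ M)))
                (ℤₚ.neg-mono-≤ (+≤+ (ℕₚ.m≤m+n M (k ℕ.* M))))

normalised-translation-unique : ∀ {m n} (B B′ : OrdPart (suc m) n) {u u′ : Pt (suc m)} →
                                Normalised B → Normalised B′ → Congruent (u′ -ᵖ u) →
                                SameFace B′ u′ B u → u′ ≗ u
normalised-translation-unique {m} B@(β , _) B′ {u} {u′} B-normal B′-normal t-congruent B′≈B j =
  ℤₚ.i-j≡0⇒i≡j (u′ j) (u j) (trans tj≡zM zM≡0)
  where
  t = u′ -ᵖ u
  forward : ∀ {y} → InVert B′ y → InVert B (y +ᵖ t)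
  forward = SameFace⇒shift B′ {u′} B {u} B′≈B
  backward : ∀ {y} → InVert B y → InVert B′ (y +ᵖ (u -ᵖ u′))
  backward = SameFace⇒shift B {u} B′ {u′} (SameFace-sym B′ B B′≈B)
  swap-sign : ∀ a b → - (a - b) ≡ b - a
  swap-sign = solve-∀
  t0≡0 : t zero ≡ + 0
  t0≡0 = ℤₚ.≤-antisym
    (subst (ℤ._≤ + 0) (swap-sign (u zero) (u′ zero))
           (ℤₚ.neg-mono-≤ (shift-at-zero-nonneg B′ B B-normal backward)))
    (shift-at-zero-nonneg B B′ B′-normal forward)
  z = proj₁ (t-congruent j)
  tj≡zM : t j ≡ z * + suc m
  tj≡zM = trans (proj₂ (t-congruent j)) (trans (cong (_+ z * + suc m) t0≡0) (ℤₚ.+-identityˡ _))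
  y = proj₁ (first-in-block B′ zero)
  y∈B′ = proj₁ (proj₂ (first-in-block B′ zero))
  y-range = block-bounded⇒range {β = proj₁ B′} (proj₂ y∈B′) j
  y+t-range = block-bounded⇒range {β = β} (proj₂ (forward y∈B′)) j
  zM≡0 : z * + suc m ≡ + 0
  zM≡0 = multiple-in-range (suc m) z (proj₁ y-range) (proj₂ y-range)
    (subst (λ s → + 0 ℤ.< y j + s) tj≡zM (proj₁ y+t-range))
    (subst (λ s → y j + s ℤ.≤ + suc m) tj≡zM (proj₂ y+t-range))

normalised-face-unique : ∀ {m n} (B B′ : OrdPart (suc m) n) {u u′ : Pt (suc m)} →
                         Normalised B → Normalised B′ → InΛ (suc m) u → InΛ (suc m) u′ →
                         SameFace B′ u′ B u → proj₁ B′ ≗ proj₁ B × u′ ≗ u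
normalised-face-unique B B′ B-normal B′-normal u∈Λ u′∈Λ B′≈B =
  same-vertices⇒same-blocks B′ B
    (SameFace⇒same-vertices B′ B u′≗u B′≈B)
    (SameFace⇒same-vertices B B′ (sym ∘ u′≗u) (SameFace-sym B′ B B′≈B)) ,
  u′≗u
  where
  u′≗u = normalised-translation-unique B B′ B-normal B′-normal
           (InΛ⇒Congruent (InΛ-− u′∈Λ u∈Λ)) B′≈B

interval-+ : ∀ {lo hi lo′ hi′ c u : ℤ} → lo ≡ lo′ + c → hi ≡ hi′ + c →
             (lo′ ℤ.< u) × (u ℤ.≤ hi′) → (lo ℤ.< u + c) × (u + c ℤ.≤ hi)
interval-+ {c = c} {u} lo≡ hi≡ (lo′<u , u≤hi′) =
  subst (ℤ._< u + c) (sym lo≡) (ℤₚ.+-monoˡ-< c lo′<u) ,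
  subst (u + c ℤ.≤_) (sym hi≡) (ℤₚ.+-monoˡ-≤ c u≤hi′)

interval-− : ∀ {lo hi lo′ hi′ c u : ℤ} → lo ≡ lo′ + c → hi ≡ hi′ + c →
             (lo ℤ.< u) × (u ℤ.≤ hi) → (lo′ ℤ.< u - c) × (u - c ℤ.≤ hi′)
interval-− {lo′ = lo′} {hi′} {c} {u} lo≡ hi≡ (lo<u , u≤hi) =
  subst (ℤ._< u - c) (trans (cong (_- c) lo≡) (//-rightDividesʳ c lo′)) (ℤₚ.+-monoˡ-< (- c) lo<u) ,
  subst (u - c ℤ.≤_) (trans (cong (_- c) hi≡) (//-rightDividesʳ c hi′)) (ℤₚ.+-monoˡ-≤ (- c) u≤hi)

rotate : ∀ {n} → Fin (suc n) → Fin (suc n)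
rotate {n} zero    = fromℕ n
rotate     (suc i) = inject₁ i

rotate-injective : ∀ {n} → Injective _≡_ _≡_ (rotate {n})
rotate-injective {x = zero}  {zero}  _ = refl
rotate-injective {x = zero}  {suc j} e = ⊥-elim (Finₚ.fromℕ≢inject₁ e)
rotate-injective {x = suc i} {zero}  e = ⊥-elim (Finₚ.fromℕ≢inject₁ (sym e))
rotate-injective {x = suc i} {suc j} e = cong suc (Finₚ.inject₁-injective e)

rotate-surjective : ∀ {n} (t : Fin (suc n)) → ∃ λ g → rotate g ≡ t
rotate-surjective {n} t with n ℕₚ.≟ toℕ t
... | yes n≡t = zero , Finₚ.toℕ-injective (trans (Finₚ.toℕ-fromℕ n) n≡t)
... | no  n≢t = suc (lower₁ t n≢t) , Finₚ.inject₁-lower₁ t n≢t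

toℕ-rotate : ∀ {n r} {g : Fin (suc n)} → toℕ g ≡ suc r → toℕ (rotate g) ≡ r
toℕ-rotate {g = suc i} e = trans (Finₚ.toℕ-inject₁ i) (ℕₚ.suc-injective e)

-- Relative to the translation by δ = - Σ_{a ∈ B₁} w_a, the values s + 1, …, m
-- taken on B₂ ∪ … ∪ Bₖ drop by s = |B₁| and the values 1, …, s taken on B₁
-- rise by m - s, which turns [B₁, B₂, …, Bₖ] into [B₂, …, Bₖ, B₁].
module Rotation {m n} (γ : Fin m → Fin (suc n)) (γ-onto : ∀ t → ∃ λ a → γ a ≡ t) where

  γ′ : Fin m → Fin (suc n)
  γ′ = rotate ∘ γ

  rotated : OrdPart m (suc n)
  rotated = γ′ , λ t →
    let (g , g↦t) = rotate-surjective t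
        (a , a↦g) = γ-onto g
    in a , trans (cong rotate a↦g) g↦t

  s : ℕ
  s = bnd γ 1

  bnd-rotated : ∀ t → t ≤ n → bnd γ′ t ℕ.+ s ≡ bnd γ (suc t)
  bnd-rotated t t≤n = count-+ (below γ′ t) (below γ 1) (below γ (suc t)) (pointwise ∘ γ)
    where
    pointwise : ∀ (g : Fin (suc n)) →
                indicator (suc (toℕ (rotate g)) ≤ᵇ t) ℕ.+ indicator (suc (toℕ g) ≤ᵇ 1)
                  ≡ indicator (suc (toℕ g) ≤ᵇ suc t)
    pointwise zero rewrite Finₚ.toℕ-fromℕ n =
      cong (ℕ._+ 1) (indicator-false λ n<t → ℕₚ.<⇒≱ (ℕₚ.<ᵇ⇒< n t n<t) t≤n)
    pointwise (suc i) rewrite Finₚ.toℕ-inject₁ i = ℕₚ.+-identityʳ _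

  shift : Fin (suc n) → ℤ
  shift zero    = + s - + m
  shift (suc _) = + s

  lower-shift : ∀ g → + bnd γ (toℕ g) ≡ + bnd γ′ (toℕ (rotate g)) + shift g
  lower-shift zero rewrite Finₚ.toℕ-fromℕ n = begin
    + bnd γ 0                   ≡⟨ cong +_ (bnd-zero γ) ⟩
    + 0                         ≡⟨ ℤₚ.+-inverseʳ (+ m) ⟨
    + m - + m                   ≡⟨ cong (λ k → + k - + m) (trans (bnd-rotated n ℕₚ.≤-refl) (bnd-full γ)) ⟨
    + (bnd γ′ n ℕ.+ s) - + m    ≡⟨ ℤₚ.+-assoc (+ bnd γ′ n) (+ s) (- + m) ⟩
    + bnd γ′ n + (+ s - + m)    ∎
    where open ≡-Reasoning
  lower-shift (suc i) rewrite Finₚ.toℕ-inject₁ i =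
    cong +_ (sym (bnd-rotated (toℕ i) (ℕₚ.<⇒≤ (Finₚ.toℕ<n i))))

  upper-shift : ∀ g → + bnd γ (suc (toℕ g)) ≡ + bnd γ′ (suc (toℕ (rotate g))) + shift g
  upper-shift zero rewrite Finₚ.toℕ-fromℕ n =
    sym (trans (cong (λ k → + k + (+ s - + m)) (bnd-full γ′)) (+-−-cancelˡ (+ m) (+ s)))
    where
    +-−-cancelˡ : ∀ i j → i + (j - i) ≡ j
    +-−-cancelˡ = solve-∀
  upper-shift (suc i) rewrite Finₚ.toℕ-inject₁ i =
    cong +_ (sym (bnd-rotated (suc (toℕ i)) (Finₚ.toℕ<n i)))

  inFirstBlock : Fin m → ℤ
  inFirstBlock a = if below γ 1 a then + 1 else + 0

  δ : Pt m
  δ = combo m (λ a → - inFirstBlock a)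

  δ∈Λ : InΛ m δ
  δ∈Λ = (λ a → - inFirstBlock a) , λ _ → refl

  δ≡shift : ∀ a → δ a ≡ shift (γ a)
  δ≡shift a = begin
    δ a                                                   ≡⟨ combo-formula m (λ a → - inFirstBlock a) a ⟩
    - inFirstBlock a * + m - sumℤ (λ a → - inFirstBlock a) ≡⟨ cong (_-_ (- inFirstBlock a * + m)) Σ≡-s ⟩
    - inFirstBlock a * + m - - + s                        ≡⟨ coefficient (γ a) ⟩
    shift (γ a)                                           ∎
    where
    open ≡-Reasoning
    Σ≡-s : sumℤ (λ a → - inFirstBlock a) ≡ - + s
    Σ≡-s = trans (sumℤ-neg inFirstBlock) (cong -_ (sumℤ-indicator (below γ 1)))
    first : ∀ M S → - + 1 * M - - S ≡ S - M
    first = solve-∀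
    later : ∀ M S → - + 0 * M - - S ≡ S
    later = solve-∀
    coefficient : ∀ g → - (if suc (toℕ g) ≤ᵇ 1 then + 1 else + 0) * + m - - + s ≡ shift g
    coefficient zero    = first (+ m) (+ s)
    coefficient (suc _) = later (+ m) (+ s)

  δ-constant : ∀ {a b} → γ a ≡ γ b → δ a ≡ δ b
  δ-constant {a} {b} γa≡γb = trans (δ≡shift a) (trans (cong shift γa≡γb) (sym (δ≡shift b)))

  lower-δ : ∀ a → + bnd γ (toℕ (γ a)) ≡ + bnd γ′ (toℕ (γ′ a)) + δ a
  lower-δ a = trans (lower-shift (γ a)) (cong (_+_ (+ bnd γ′ (toℕ (γ′ a)))) (sym (δ≡shift a)))

  upper-δ : ∀ a → + bnd γ (suc (toℕ (γ a))) ≡ + bnd γ′ (suc (toℕ (γ′ a))) + δ a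
  upper-δ a = trans (upper-shift (γ a)) (cong (_+_ (+ bnd γ′ (suc (toℕ (γ′ a))))) (sym (δ≡shift a)))

  rotated-vertex⇒vertex : ∀ {y} → InVert rotated y → InVert (γ , γ-onto) (y +ᵖ δ)
  rotated-vertex⇒vertex {y} (y-perm , y-bounded) =
    InVert-intro (γ , γ-onto) y+δ-bounded
      (+ᵖ-injective {y = y} {c = δ} (IsPermVec⇒injective y-perm)
        (δ-constant ∘ block-bounded⇒same-block y+δ-bounded))
    where
    y+δ-bounded : BlockBounded γ (y +ᵖ δ)
    y+δ-bounded a = interval-+ (lower-δ a) (upper-δ a) (y-bounded a)

  vertex⇒rotated-vertex : ∀ {y} → InVert (γ , γ-onto) y → InVert rotated (y -ᵖ δ)
  vertex⇒rotated-vertex {y} (y-perm , y-bounded) =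
    InVert-intro rotated y-δ-bounded
      (+ᵖ-injective {y = y} {c = λ a → - δ a} (IsPermVec⇒injective y-perm)
        (cong -_ ∘ δ-constant ∘ rotate-injective ∘ block-bounded⇒same-block y-δ-bounded))
    where
    y-δ-bounded : BlockBounded γ′ (y -ᵖ δ)
    y-δ-bounded a = interval-− (lower-δ a) (upper-δ a) (y-bounded a)

  rotate-face : ∀ w → SameFace rotated (w +ᵖ δ) (γ , γ-onto) w
  rotate-face w x =
    (λ x∈rotated → InVert-resp-≗ (γ , γ-onto) (λ j → untranslate (x j) (w j) (δ j))
                     (rotated-vertex⇒vertex x∈rotated)) ,
    (λ x∈C → InVert-resp-≗ rotated (λ j → retranslate (x j) (w j) (δ j))
               (vertex⇒rotated-vertex x∈C))
    where
    untranslate : ∀ x w d → x - (w + d) + d ≡ x - w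
    untranslate = solve-∀
    retranslate : ∀ x w d → x - w - d ≡ x - (w + d)
    retranslate = solve-∀

normalise : ∀ {m n} r (C : OrdPart (suc m) (suc n)) → toℕ (proj₁ C zero) ≡ r →
            ∀ w → InΛ (suc m) w →
            Σ (OrdPart (suc m) (suc n)) λ B → Σ (Pt (suc m)) λ v →
              Normalised B × InΛ (suc m) v × SameFace B v C w
normalise zero    C       C-normal w w∈Λ = C , w , C-normal , w∈Λ , SameFace-refl C w
normalise (suc r) (γ , γ-onto) γ0≡ w w∈Λ =
  let (B , v , B-normal , v∈Λ , B≈rotated) =
        normalise r rotated (toℕ-rotate γ0≡) (w +ᵖ δ) (InΛ-+ w∈Λ δ∈Λ)
  in B , v , B-normal , v∈Λ , SameFace-trans B rotated (γ , γ-onto) B≈rotated (rotate-face w)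
  where open Rotation γ γ-onto

SameFace⇒SameFaceH : ∀ {d k n n′} (B : OrdPart (suc d) n) {v} (C : OrdPart (suc d) n′) {w} →
                     SameFace B v C w → SameFaceH d k B v C w
SameFace⇒SameFaceH {d} {k} B {v} C B≈C =
  (λ _ → + 0) , InL-zero d k , SameFace-resp-≗ B C (λ j → sym (ℤₚ.+-identityʳ (v j))) B≈C

heawood-unique : ∀ {d k n} (C : OrdPart (suc d) n) {w} (B : OrdPart (suc d) n) {v} →
                 Normalised B → InΛ (suc d) v → SameFace B v C w →
                 (B′ : OrdPart (suc d) n) (v′ : Pt (suc d)) →
                 Normalised B′ → InΛ (suc d) v′ → SameFaceH d k B′ v′ C w →
                 proj₁ B′ ≗ proj₁ B × InL d k (v′ -ᵖ v)
heawood-unique {d} {k} C B B-normal v∈Λ B≈C B′ v′ B′-normal v′∈Λ (ℓ , ℓ∈L , B′≈C) =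
  let (β′≗β , v′+ℓ≗v) = normalised-face-unique B B′ B-normal B′-normal v∈Λ
                          (InΛ-+ v′∈Λ (InL⇒InΛ {k = k} ℓ∈L))
                          (SameFace-trans B′ C B B′≈C (SameFace-sym B C B≈C))
  in β′≗β ,
     InL-resp-≗ {k = k} (λ j → trans (cong (_-_ (v′ j)) (sym (v′+ℓ≗v j))) (minus-sum (v′ j) (ℓ j)))
                        (InL-neg {k = k} ℓ∈L)
  where
  minus-sum : ∀ a b → a - (a + b) ≡ - b
  minus-sum = solve-∀

corollary5p5 : (d : ℕ) → 2 ≤ d →
    (k : Fin (suc d) → ℕ) → (∀ i → 1 ≤ k i) →
    (n : ℕ) → 1 ≤ n → n ≤ suc d →
    (C : OrdPart (suc d) n) → (w : Pt (suc d)) → InΛ (suc d) w →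
    Σ (OrdPart (suc d) n) (λ B → Σ (Pt (suc d)) (λ v →
        (toℕ (proj₁ B zero) ≡ 0) × InΛ (suc d) v × SameFaceH d k B v C w
        × ((B′ : OrdPart (suc d) n) → (v′ : Pt (suc d)) →
            toℕ (proj₁ B′ zero) ≡ 0 → InΛ (suc d) v′ →
            SameFaceH d k B′ v′ C w →
            (∀ a → proj₁ B′ a ≡ proj₁ B a) × InL d k (v′ -ᵖ v))))
corollary5p5 d _ k _ zero    () _ C w w∈Λ
corollary5p5 d _ k _ (suc n) _  _ C w w∈Λ =
  let (B , v , B-normal , v∈Λ , B≈C) = normalise (toℕ (proj₁ C zero)) C refl w w∈Λ
  in B , v , B-normal , v∈Λ , SameFace⇒SameFaceH {k = k} B C B≈C ,
     heawood-unique {k = k} C B B-normal v∈Λ B≈C
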